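{- For every order function $h$ there exists an order function $g$ such that every $\mathrm{DNR}_g$ function computes an $\mathrm{SNPR}_h$ function.
   Context: Let $\varphi_e$ denote the $e$-th partial recursive function. A function $f:\omega\to\omega$ is $\mathrm{DNR}$ (diagonally non-recursive) if $f(n)\neq\varphi_n(n)$ for every $n$ such that $\varphi_n(n)$ is defined. A function $f:\omega\to\omega$ is strongly non-partial-recursive ($\mathrm{SNPR}$) if for every partial recursive function $\psi$, for all but finitely many $n$, if $\psi(n)$ is defined then $f(n)\neq\psi(n)$. An order function is a recursive, nondecreasing, unbounded function $h:\omega\to\omega$ with $h(0)\ge 2$. For a class $\mathrm{C}$ of functions $\omega\to\omega$ and an order function $h$, $\mathrm{C}_h$ denotes the subclass of members of $\mathrm{C}$ bounded by $h$ (i.e. $f(n)<h(n)$ for all $n$). "Computes" means Turing computes. -}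

module Defs where

open import Data.Nat using (ℕ; zero; suc; _+_; _*_; _≤_; _<_)
open import Data.Nat.DivMod using (_/_; _%_)
open import Data.Product using (Σ; ∃; _×_; _,_)
open import Data.Maybe using (Maybe; just; nothing)
open import Relation.Binary.PropositionalEquality using (_≡_; _≢_)

tri : ℕ → ℕ
tri zero    = zero
tri (suc k) = tri k + suc k

pair : ℕ → ℕ → ℕ
pair x y = tri (x + y) + x

nextPair : ℕ × ℕ → ℕ × ℕ
nextPair (x , zero)  = (zero , suc x)
nextPair (x , suc y) = (suc x , y)

unpair : ℕ → ℕ × ℕ
unpair zero    = (zero , zero)
unpair (suc n) = nextPair (unpair n)

fst' : ℕ × ℕ → ℕ
fst' (x , _) = x

snd' : ℕ × ℕ → ℕ
snd' (_ , y) = y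

-- Unary oracle μ-recursive programs (Turing complete; multi-argument
-- functions are handled through the pairing function).

data Code : Set where
  Z    : Code
  S    : Code
  L    : Code
  R    : Code
  O    : Code
  I    : Code
  comp : Code → Code → Code
  prd  : Code → Code → Code
  rec  : Code → Code → Code   -- rec c d : ⟨x,0⟩ ↦ c x ; ⟨x,n+1⟩ ↦ d ⟨⟨x,n⟩ , rec c d ⟨x,n⟩⟩
  mu   : Code → Code          -- mu c : x ↦ least n with c⟨x,n⟩ = 0 (all earlier values defined)

mutual
  eval : (ℕ → ℕ) → ℕ → Code → ℕ → Maybe ℕ
  eval f zero    _          _ = nothing
  eval f (suc s) Z          x = just zero
  eval f (suc s) S          x = just (suc x)
  eval f (suc s) L          x = just (fst' (unpair x))
  eval f (suc s) R          x = just (snd' (unpair x))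
  eval f (suc s) O          x = just (f x)
  eval f (suc s) I          x = just x
  eval f (suc s) (comp c d) x with eval f s d x
  ... | nothing = nothing
  ... | just y  = eval f s c y
  eval f (suc s) (prd c d)  x with eval f s c x | eval f s d x
  ... | just a  | just b = just (pair a b)
  ... | _       | _      = nothing
  eval f (suc s) (rec c d)  x = evalRec f s c d (fst' (unpair x)) (snd' (unpair x))
  eval f (suc s) (mu c)     x = search f s c x zero

  evalRec : (ℕ → ℕ) → ℕ → Code → Code → ℕ → ℕ → Maybe ℕ
  evalRec f s c d x zero    = eval f s c x
  evalRec f zero    c d x (suc n) = nothing
  evalRec f (suc s) c d x (suc n) with evalRec f s c d x n
  ... | nothing = nothing
  ... | just r  = eval f s d (pair (pair x n) r)

  search : (ℕ → ℕ) → ℕ → Code → ℕ → ℕ → Maybe ℕ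
  search f zero    c x n = nothing
  search f (suc s) c x n with eval f s c (pair x n)
  ... | nothing      = nothing
  ... | just zero    = just n
  ... | just (suc _) = search f s c x (suc n)

-- Gödel numbering of programs:  e = 10 * m + tag,  components = unpair m.

decodeF : ℕ → ℕ → Code
decodeF zero     n = Z
decodeF (suc fu) n = go (n % 10) (unpair (n / 10))
  where
  go : ℕ → ℕ × ℕ → Code
  go 0 _       = Z
  go 1 _       = S
  go 2 _       = L
  go 3 _       = R
  go 4 _       = O
  go 5 _       = I
  go 6 (a , b) = comp (decodeF fu a) (decodeF fu b)
  go 7 (a , b) = prd  (decodeF fu a) (decodeF fu b)
  go 8 (a , b) = rec  (decodeF fu a) (decodeF fu b)
  go 9 (a , _) = mu   (decodeF fu a)
  go _ _       = Z

decode : ℕ → Code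
decode n = decodeF n n

_⟦_⟧_↓_ : (ℕ → ℕ) → ℕ → ℕ → ℕ → Set
f ⟦ e ⟧ x ↓ v = ∃ λ s → eval f s (decode e) x ≡ just v

φ_⟨_⟩↓_ : ℕ → ℕ → ℕ → Set
φ e ⟨ x ⟩↓ v = (λ _ → 0) ⟦ e ⟧ x ↓ v

_Computes_ : (ℕ → ℕ) → (ℕ → ℕ) → Set
g Computes f = ∃ λ e → ∀ x → g ⟦ e ⟧ x ↓ f x

Recursive : (ℕ → ℕ) → Set
Recursive h = ∃ λ e → ∀ x → φ e ⟨ x ⟩↓ h x

OrderFunction : (ℕ → ℕ) → Set
OrderFunction h =
  Recursive h
  × (∀ m n → m ≤ n → h m ≤ h n)
  × (∀ m → ∃ λ n → m ≤ h n)
  × 2 ≤ h 0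

BoundedBy : (ℕ → ℕ) → (ℕ → ℕ) → Set
BoundedBy f h = ∀ n → f n < h n

DNR : (ℕ → ℕ) → Set
DNR f = ∀ n v → φ n ⟨ n ⟩↓ v → f n ≢ v

SNPR : (ℕ → ℕ) → Set
SNPR f = ∀ e → ∃ λ N → ∀ n → N ≤ n → ∀ v → φ e ⟨ n ⟩↓ v → f n ≢ v

-- Let width n be the largest l such that every l-tuple with entries at most l + 1
-- has a code below h n; it is recursive, nondecreasing and unbounded.  Let a n e be
-- an index of the program that outputs the e-th entry of the tuple coded by φ_e(n),
-- and put f' n = ⟨f (a n 0), …, f (a n (width n ∸ 1))⟩.  If φ_e(n) = f' n with
-- e < width n, then φ_{a n e}(a n e) = f (a n e), which a DNR function forbids; since
-- width is unbounded this excludes all large n, so f' is SNPR.  Finally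
-- g m = width (stage m) + 2, with stage inverting n ↦ a n (width n), is an order
-- function bounding every queried value f (a n e) by width n + 1, whence f' n < h n.

module Submission where

open import Defs
open import Data.Nat
open import Data.Nat.Properties
open import Data.Nat.DivMod
open import Data.Nat.Divisibility using (divides-refl)
open import Data.Product using (Σ; ∃; _×_; _,_; uncurry)
open import Data.Maybe using (Maybe; just; nothing)
open import Relation.Binary.PropositionalEquality
open import Function using (_∘_)
open import Data.Sum using (inj₁; inj₂)
open import Relation.Nullary using (contradiction)
open import Relation.Binary using (_Preserves_⟶_)

-- Cantor pairing

mutual
  unpair-tri : ∀ s → unpair (tri s) ≡ (0 , s)
  unpair-tri zero = refl
  unpair-tri (suc s) rewrite +-suc (tri s) s | unpair-tri+ s s ≤-refl | n∸n≡0 s = refl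

  unpair-tri+ : ∀ s x → x ≤ s → unpair (tri s + x) ≡ (x , s ∸ x)
  unpair-tri+ s zero _ rewrite +-identityʳ (tri s) = unpair-tri s
  unpair-tri+ s (suc x) x<s
    rewrite +-suc (tri s) x | unpair-tri+ s x (<⇒≤ x<s) | +-∸-assoc 1 x<s = refl

unpair-pair : ∀ x y → unpair (pair x y) ≡ (x , y)
unpair-pair x y rewrite unpair-tri+ (x + y) x (m≤m+n x y) | m+n∸m≡n x y = refl

pair-nextPair : ∀ p → uncurry pair (nextPair p) ≡ suc (uncurry pair p)
pair-nextPair (x , zero) rewrite +-identityʳ (tri x + suc x) | +-identityʳ x = +-suc (tri x) x
pair-nextPair (x , suc y) rewrite +-suc x y = +-suc (tri (suc (x + y))) x

pair-unpair : ∀ m → uncurry pair (unpair m) ≡ m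
pair-unpair zero = refl
pair-unpair (suc m) = trans (pair-nextPair (unpair m)) (cong suc (pair-unpair m))


tri-mono-≤ : ∀ {a b} → a ≤ b → tri a ≤ tri b
tri-mono-≤ {zero} _ = z≤n
tri-mono-≤ {suc a} {suc b} (s≤s a≤b) = +-mono-≤ (tri-mono-≤ a≤b) (s≤s a≤b)

n≤tri : ∀ n → n ≤ tri n
n≤tri zero = z≤n
n≤tri (suc n) = subst (suc n ≤_) (sym (+-suc (tri n) n)) (s≤s (m≤n+m n (tri n)))

pair-mono-≤ : ∀ {a b c d} → a ≤ b → c ≤ d → pair a c ≤ pair b d
pair-mono-≤ a≤b c≤d = +-mono-≤ (tri-mono-≤ (+-mono-≤ a≤b c≤d)) a≤b

+≤pair : ∀ x y → x + y ≤ pair x y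
+≤pair x y = ≤-trans (n≤tri (x + y)) (m≤m+n _ x)

≤-pairˡ : ∀ x y → x ≤ pair x y
≤-pairˡ x y = m≤n+m x _

≤-pairʳ : ∀ x y → y ≤ pair x y
≤-pairʳ x y = ≤-trans (m≤n+m y x) (+≤pair x y)

fst'-unpair-≤ : ∀ m → fst' (unpair m) ≤ m
fst'-unpair-≤ m = subst (fst' (unpair m) ≤_) (pair-unpair m) (≤-pairˡ _ (snd' (unpair m)))

snd'-unpair-≤ : ∀ m → snd' (unpair m) ≤ m
snd'-unpair-≤ m = subst (snd' (unpair m) ≤_) (pair-unpair m) (≤-pairʳ (fst' (unpair m)) _)

-- Gödel numbering

node : ℕ → ℕ → ℕ → ℕ
node t x y = t + pair x y * 10

node-% : ∀ t x y → t < 10 → node t x y % 10 ≡ t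
node-% t x y t<10 = trans ([m+kn]%n≡m%n t (pair x y) 10) (m<n⇒m%n≡m t<10)

node-/ : ∀ t x y → t < 10 → node t x y / 10 ≡ pair x y
node-/ t x y t<10 =
  trans (+-distrib-/-∣ʳ t (divides-refl (pair x y))) (cong₂ _+_ (m<n⇒m/n≡0 t<10) (m*n/n≡m (pair x y) 10))

pair≤node : ∀ t x y → pair x y ≤ node t x y
pair≤node t x y = ≤-trans (m≤m*n (pair x y) 10) (m≤n+m _ t)

≤-nodeˡ : ∀ t x y → x ≤ node t x y
≤-nodeˡ t x y = ≤-trans (≤-pairˡ x y) (pair≤node t x y)

≤-nodeʳ : ∀ t x y → y ≤ node t x y
≤-nodeʳ t x y = ≤-trans (≤-pairʳ x y) (pair≤node t x y)

suc/10≤ : ∀ m → suc m / 10 ≤ m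
suc/10≤ m = s≤s⁻¹ (m/n<m (suc m) 10 (s≤s (s≤s z≤n)))

decodeF-fuel : ∀ f₁ f₂ n → n ≤ f₁ → n ≤ f₂ → decodeF f₁ n ≡ decodeF f₂ n
decodeF-fuel zero     zero     zero _ _ = refl
decodeF-fuel zero     (suc f₂) zero _ _ = refl
decodeF-fuel (suc f₁) zero     zero _ _ = refl
decodeF-fuel (suc f₁) (suc f₂) zero _ _ = refl
decodeF-fuel (suc f₁) (suc f₂) (suc m) (s≤s m≤f₁) (s≤s m≤f₂) = go
  where
  IH : ∀ {a} → a ≤ m → decodeF f₁ a ≡ decodeF f₂ a
  IH a≤m = decodeF-fuel f₁ f₂ _ (≤-trans a≤m m≤f₁) (≤-trans a≤m m≤f₂)
  go : decodeF (suc f₁) (suc m) ≡ decodeF (suc f₂) (suc m)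
  go with suc m % 10 | unpair (suc m / 10)
        | ≤-trans (fst'-unpair-≤ (suc m / 10)) (suc/10≤ m)
        | ≤-trans (snd'-unpair-≤ (suc m / 10)) (suc/10≤ m)
  ... | 0 | _ | _ | _ = refl
  ... | 1 | _ | _ | _ = refl
  ... | 2 | _ | _ | _ = refl
  ... | 3 | _ | _ | _ = refl
  ... | 4 | _ | _ | _ = refl
  ... | 5 | _ | _ | _ = refl
  ... | 6 | (a , b) | a≤m | b≤m = cong₂ comp (IH a≤m) (IH b≤m)
  ... | 7 | (a , b) | a≤m | b≤m = cong₂ prd (IH a≤m) (IH b≤m)
  ... | 8 | (a , b) | a≤m | b≤m = cong₂ rec (IH a≤m) (IH b≤m)
  ... | 9 | (a , _) | a≤m | _   = cong mu (IH a≤m)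
  ... | suc (suc (suc (suc (suc (suc (suc (suc (suc (suc _))))))))) | _ | _ | _ = refl

decodeF-nodeˡ : ∀ t x y → decodeF (t + pair x y * 10) x ≡ decode x
decodeF-nodeˡ t x y = decodeF-fuel _ x x (≤-nodeˡ t x y) ≤-refl

decodeF-nodeʳ : ∀ t x y → decodeF (t + pair x y * 10) y ≡ decode y
decodeF-nodeʳ t x y = decodeF-fuel _ y y (≤-nodeʳ t x y) ≤-refl

decode-comp : ∀ x y → decode (node 6 x y) ≡ comp (decode x) (decode y)
decode-comp x y rewrite node-% 6 x y (<ᵇ⇒< 6 10 _) | node-/ 6 x y (<ᵇ⇒< 6 10 _) | unpair-pair x y =
  cong₂ comp (decodeF-nodeˡ 5 x y) (decodeF-nodeʳ 5 x y)

decode-prd : ∀ x y → decode (node 7 x y) ≡ prd (decode x) (decode y)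
decode-prd x y rewrite node-% 7 x y (<ᵇ⇒< 7 10 _) | node-/ 7 x y (<ᵇ⇒< 7 10 _) | unpair-pair x y =
  cong₂ prd (decodeF-nodeˡ 6 x y) (decodeF-nodeʳ 6 x y)

decode-rec : ∀ x y → decode (node 8 x y) ≡ rec (decode x) (decode y)
decode-rec x y rewrite node-% 8 x y (<ᵇ⇒< 8 10 _) | node-/ 8 x y (<ᵇ⇒< 8 10 _) | unpair-pair x y =
  cong₂ rec (decodeF-nodeˡ 7 x y) (decodeF-nodeʳ 7 x y)

decode-mu : ∀ x → decode (node 9 x 0) ≡ mu (decode x)
decode-mu x rewrite node-% 9 x 0 (<ᵇ⇒< 9 10 _) | node-/ 9 x 0 (<ᵇ⇒< 9 10 _) | unpair-pair x 0 =
  cong mu (decodeF-nodeˡ 8 x 0)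

encode : Code → ℕ
encode Z          = 0
encode S          = 1
encode L          = 2
encode R          = 3
encode O          = 4
encode I          = 5
encode (comp c d) = node 6 (encode c) (encode d)
encode (prd c d)  = node 7 (encode c) (encode d)
encode (rec c d)  = node 8 (encode c) (encode d)
encode (mu c)     = node 9 (encode c) 0

decode-encode : ∀ c → decode (encode c) ≡ c
decode-encode Z          = refl
decode-encode S          = refl
decode-encode L          = refl
decode-encode R          = refl
decode-encode O          = refl
decode-encode I          = refl
decode-encode (comp c d) = trans (decode-comp (encode c) (encode d)) (cong₂ comp (decode-encode c) (decode-encode d))
decode-encode (prd c d)  = trans (decode-prd (encode c) (encode d)) (cong₂ prd (decode-encode c) (decode-encode d))
decode-encode (rec c d)  = trans (decode-rec (encode c) (encode d)) (cong₂ rec (decode-encode c) (decode-encode d))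
decode-encode (mu c)     = trans (decode-mu (encode c)) (cong mu (decode-encode c))

-- Fuel-bounded evaluation

infix 4 _⇓_ _⊢_·_⇓_

_⇓_ : (ℕ → Maybe ℕ) → ℕ → Set
run ⇓ v = ∃ λ s → run s ≡ just v

_⊢_·_⇓_ : (ℕ → ℕ) → Code → ℕ → ℕ → Set
f ⊢ c · x ⇓ v = (λ s → eval f s c x) ⇓ v

Increasing : (ℕ → Maybe ℕ) → Set
Increasing run = ∀ s {v} → run s ≡ just v → run (suc s) ≡ just v

increasing-≤′ : ∀ {run} → Increasing run → ∀ {s s' v} → s ≤′ s' → run s ≡ just v → run s' ≡ just v
increasing-≤′ inc ≤′-refl         run≡v = run≡v
increasing-≤′ inc (≤′-step s≤′s') run≡v = inc _ (increasing-≤′ inc s≤′s' run≡v)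

⇓-zip : ∀ {r₁ r₂ a b} → Increasing r₁ → Increasing r₂ → r₁ ⇓ a → r₂ ⇓ b →
        ∃ λ s → r₁ s ≡ just a × r₂ s ≡ just b
⇓-zip inc₁ inc₂ (s₁ , r₁≡a) (s₂ , r₂≡b) =
  s₁ ⊔ s₂ , increasing-≤′ inc₁ (≤⇒≤′ (m≤m⊔n s₁ s₂)) r₁≡a , increasing-≤′ inc₂ (≤⇒≤′ (m≤n⊔m s₁ s₂)) r₂≡b

mutual
  eval-increasing : ∀ f c x → Increasing (λ s → eval f s c x)
  eval-increasing f c          x zero    ()
  eval-increasing f Z          x (suc s) e = e
  eval-increasing f S          x (suc s) e = e
  eval-increasing f L          x (suc s) e = e
  eval-increasing f R          x (suc s) e = e
  eval-increasing f O          x (suc s) e = e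
  eval-increasing f I          x (suc s) e = e
  eval-increasing f (comp c d) x (suc s) e with eval f s d x in d≡y
  ... | just y rewrite eval-increasing f d x s d≡y = eval-increasing f c y s e
  eval-increasing f (prd c d)  x (suc s) e with eval f s c x in c≡a | eval f s d x in d≡b
  ... | just a  | just b
    rewrite eval-increasing f c x s c≡a | eval-increasing f d x s d≡b = e
  ... | just _  | nothing with () ← e
  ... | nothing | just _  with () ← e
  ... | nothing | nothing with () ← e
  eval-increasing f (rec c d)  x (suc s) e = evalRec-increasing f c d (fst' (unpair x)) (snd' (unpair x)) s e
  eval-increasing f (mu c)     x (suc s) e = search-increasing f c x 0 s e

  evalRec-increasing : ∀ f c d x n → Increasing (λ s → evalRec f s c d x n)
  evalRec-increasing f c d x zero    s       e = eval-increasing f c x s e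
  evalRec-increasing f c d x (suc n) zero    ()
  evalRec-increasing f c d x (suc n) (suc s) e with evalRec f s c d x n in rec≡r
  ... | just r rewrite evalRec-increasing f c d x n s rec≡r = eval-increasing f d _ s e

  search-increasing : ∀ f c x n → Increasing (λ s → search f s c x n)
  search-increasing f c x n zero    ()
  search-increasing f c x n (suc s) e with eval f s c (pair x n) in c≡t
  ... | just zero    rewrite eval-increasing f c (pair x n) s c≡t = e
  ... | just (suc t) rewrite eval-increasing f c (pair x n) s c≡t = search-increasing f c x (suc n) s e

primRec : ℕ → (ℕ → ℕ → ℕ) → ℕ → ℕ
primRec a H zero    = a
primRec a H (suc n) = H n (primRec a H n)

firstZero : (ℕ → ℕ) → ℕ → ℕ → ℕ
firstZero T i zero = i
firstZero T i (suc b) with T i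
... | zero  = i
... | suc _ = firstZero T (suc i) b

module _ {f : ℕ → ℕ} where

  ⇓-Z : ∀ x → f ⊢ Z · x ⇓ 0
  ⇓-Z x = 1 , refl

  ⇓-S : ∀ x → f ⊢ S · x ⇓ suc x
  ⇓-S x = 1 , refl

  ⇓-I : ∀ x → f ⊢ I · x ⇓ x
  ⇓-I x = 1 , refl

  ⇓-O : ∀ x → f ⊢ O · x ⇓ f x
  ⇓-O x = 1 , refl

  ⇓-L : ∀ a b → f ⊢ L · pair a b ⇓ a
  ⇓-L a b = 1 , cong (just ∘ fst') (unpair-pair a b)

  ⇓-R : ∀ a b → f ⊢ R · pair a b ⇓ b
  ⇓-R a b = 1 , cong (just ∘ snd') (unpair-pair a b)

  ⇓-comp : ∀ {c d x y v} → f ⊢ d · x ⇓ y → f ⊢ c · y ⇓ v → f ⊢ comp c d · x ⇓ v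
  ⇓-comp {c} {d} {x} {y} {v} d⇓ c⇓ with ⇓-zip (eval-increasing f d x) (eval-increasing f c y) d⇓ c⇓
  ... | s , d≡y , c≡v = suc s , goal
    where goal : eval f (suc s) (comp c d) x ≡ just v
          goal rewrite d≡y = c≡v

  ⇓-prd : ∀ {c d x a b} → f ⊢ c · x ⇓ a → f ⊢ d · x ⇓ b → f ⊢ prd c d · x ⇓ pair a b
  ⇓-prd {c} {d} {x} {a} {b} c⇓ d⇓ with ⇓-zip (eval-increasing f c x) (eval-increasing f d x) c⇓ d⇓
  ... | s , c≡a , d≡b = suc s , goal
    where goal : eval f (suc s) (prd c d) x ≡ just (pair a b)
          goal rewrite c≡a | d≡b = refl

  ⇓-rec : ∀ {c d x a} H → f ⊢ c · x ⇓ a → (∀ n r → f ⊢ d · pair (pair x n) r ⇓ H n r) →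
          ∀ n → f ⊢ rec c d · pair x n ⇓ primRec a H n
  ⇓-rec {c} {d} {x} {a} H c⇓ d⇓ n =
    let s , rec≡v = recursion n
    in suc s , subst (λ p → evalRec f s c d (fst' p) (snd' p) ≡ just (primRec a H n)) (sym (unpair-pair x n)) rec≡v
    where
    recursion : ∀ n → (λ s → evalRec f s c d x n) ⇓ primRec a H n
    recursion zero = c⇓
    recursion (suc n)
      with ⇓-zip (evalRec-increasing f c d x n) (eval-increasing f d _) (recursion n) (d⇓ n _)
    ... | s , rec≡r , d≡v = suc s , goal
      where goal : evalRec f (suc s) c d x (suc n) ≡ just (primRec a H (suc n))
            goal rewrite rec≡r = d≡v

  ⇓-mu : ∀ {c x} T b → (∀ n → f ⊢ c · pair x n ⇓ T n) → T b ≡ 0 → f ⊢ mu c · x ⇓ firstZero T 0 b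
  ⇓-mu {c} {x} T b c⇓ Tb≡0 = let s , search≡v = searching 0 b Tb≡0 in suc s , search≡v
    where
    searching : ∀ i b → T (i + b) ≡ 0 → (λ s → search f s c x i) ⇓ firstZero T i b
    searching i zero Ti+0≡0 with c⇓ i
    ... | s , c≡Ti = suc s , goal
      where goal : search f (suc s) c x i ≡ just i
            goal rewrite c≡Ti | trans (cong T (sym (+-identityʳ i))) Ti+0≡0 = refl
    searching i (suc b) Ti+b≡0 with T i | c⇓ i
    ... | zero  | s , c≡0 = suc s , goal
      where goal : search f (suc s) c x i ≡ just i
            goal rewrite c≡0 = refl
    ... | suc t | c⇓t
      with ⇓-zip (eval-increasing f c _) (search-increasing f c x (suc i)) c⇓t
                 (searching (suc i) b (trans (cong T (sym (+-suc i b))) Ti+b≡0))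
    ... | s , c≡t , search≡v = suc s , goal
      where goal : search f (suc s) c x i ≡ just (firstZero T (suc i) b)
            goal rewrite c≡t = search≡v

firstZero-zero : ∀ (T : ℕ → ℕ) i b → T (i + b) ≡ 0 → T (firstZero T i b) ≡ 0
firstZero-zero T i zero    Ti+0≡0 = trans (cong T (sym (+-identityʳ i))) Ti+0≡0
firstZero-zero T i (suc b) Ti+b≡0 with T i in Ti≡t
... | zero  = Ti≡t
... | suc _ = firstZero-zero T (suc i) b (trans (cong T (sym (+-suc i b))) Ti+b≡0)

firstZero-minimal : ∀ (T : ℕ → ℕ) i b {j} → i ≤ j → j < firstZero T i b → T j ≢ 0
firstZero-minimal T i zero    i≤j j<i = contradiction i≤j (<⇒≱ j<i)
firstZero-minimal T i (suc b) i≤j j< with T i in Ti≡t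
... | zero = contradiction i≤j (<⇒≱ j<)
... | suc _ with m≤n⇒m<n∨m≡n i≤j
...   | inj₁ i<j  = firstZero-minimal T (suc i) b i<j j<
...   | inj₂ refl = λ Ti≡0 → 0≢1+n (trans (sym Ti≡0) Ti≡t)

eraseOracle : Code → Code
eraseOracle O          = Z
eraseOracle (comp c d) = comp (eraseOracle c) (eraseOracle d)
eraseOracle (prd c d)  = prd (eraseOracle c) (eraseOracle d)
eraseOracle (rec c d)  = rec (eraseOracle c) (eraseOracle d)
eraseOracle (mu c)     = mu (eraseOracle c)
eraseOracle c          = c

mutual
  eval-eraseOracle : ∀ f s c x → eval f s (eraseOracle c) x ≡ eval (λ _ → 0) s c x
  eval-eraseOracle f zero    c          x = refl
  eval-eraseOracle f (suc s) Z          x = refl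
  eval-eraseOracle f (suc s) S          x = refl
  eval-eraseOracle f (suc s) L          x = refl
  eval-eraseOracle f (suc s) R          x = refl
  eval-eraseOracle f (suc s) O          x = refl
  eval-eraseOracle f (suc s) I          x = refl
  eval-eraseOracle f (suc s) (comp c d) x rewrite eval-eraseOracle f s d x with eval (λ _ → 0) s d x
  ... | nothing = refl
  ... | just y  = eval-eraseOracle f s c y
  eval-eraseOracle f (suc s) (prd c d)  x rewrite eval-eraseOracle f s c x | eval-eraseOracle f s d x = refl
  eval-eraseOracle f (suc s) (rec c d)  x = evalRec-eraseOracle f s c d (fst' (unpair x)) (snd' (unpair x))
  eval-eraseOracle f (suc s) (mu c)     x = search-eraseOracle f s c x 0

  evalRec-eraseOracle : ∀ f s c d x n →
    evalRec f s (eraseOracle c) (eraseOracle d) x n ≡ evalRec (λ _ → 0) s c d x n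
  evalRec-eraseOracle f s       c d x zero    = eval-eraseOracle f s c x
  evalRec-eraseOracle f zero    c d x (suc n) = refl
  evalRec-eraseOracle f (suc s) c d x (suc n)
    rewrite evalRec-eraseOracle f s c d x n with evalRec (λ _ → 0) s c d x n
  ... | nothing = refl
  ... | just r  = eval-eraseOracle f s d _

  search-eraseOracle : ∀ f s c x n → search f s (eraseOracle c) x n ≡ search (λ _ → 0) s c x n
  search-eraseOracle f zero    c x n = refl
  search-eraseOracle f (suc s) c x n
    rewrite eval-eraseOracle f s c (pair x n) with eval (λ _ → 0) s c (pair x n)
  ... | nothing      = refl
  ... | just zero    = refl
  ... | just (suc _) = search-eraseOracle f s c x (suc n)

⇓-eraseOracle : ∀ {f c x v} → (λ _ → 0) ⊢ c · x ⇓ v → f ⊢ eraseOracle c · x ⇓ v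
⇓-eraseOracle {f} {c} {x} (s , c≡v) = s , trans (eval-eraseOracle f s c x) c≡v

constᶜ : ℕ → Code
constᶜ zero    = Z
constᶜ (suc n) = comp S (constᶜ n)

paramᶜ counterᶜ : Code
paramᶜ   = comp L L
counterᶜ = comp R L

addᶜ mulᶜ predᶜ monusᶜ : Code
addᶜ   = rec I (comp S R)
mulᶜ   = rec Z (comp addᶜ (prd R paramᶜ))
predᶜ  = comp (rec Z counterᶜ) (prd I I)
monusᶜ = rec I (comp predᶜ R)

nodeᶜ : ℕ → Code
nodeᶜ t = comp addᶜ (prd (constᶜ t) (comp mulᶜ (prd (constᶜ 10) I)))

primRec-+ : ∀ a b → primRec a (λ _ → suc) b ≡ a + b
primRec-+ a zero    = sym (+-identityʳ a)
primRec-+ a (suc b) = trans (cong suc (primRec-+ a b)) (sym (+-suc a b))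

primRec-* : ∀ a b → primRec 0 (λ _ r → r + a) b ≡ b * a
primRec-* a zero    = refl
primRec-* a (suc b) = trans (cong (_+ a) (primRec-* a b)) (+-comm (b * a) a)

primRec-pred : ∀ x → primRec 0 (λ n _ → n) x ≡ pred x
primRec-pred zero    = refl
primRec-pred (suc x) = refl

primRec-∸ : ∀ a b → primRec a (λ _ → pred) b ≡ a ∸ b
primRec-∸ a zero    = refl
primRec-∸ a (suc b) = trans (cong pred (primRec-∸ a b)) (pred[m∸n]≡m∸[1+n] a b)

module _ {f : ℕ → ℕ} where

  ⇓-const : ∀ n x → f ⊢ constᶜ n · x ⇓ n
  ⇓-const zero    x = ⇓-Z x
  ⇓-const (suc n) x = ⇓-comp (⇓-const n x) (⇓-S n)

  ⇓-param : ∀ x n r → f ⊢ paramᶜ · pair (pair x n) r ⇓ x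
  ⇓-param x n r = ⇓-comp (⇓-L (pair x n) r) (⇓-L x n)

  ⇓-counter : ∀ x n r → f ⊢ counterᶜ · pair (pair x n) r ⇓ n
  ⇓-counter x n r = ⇓-comp (⇓-L (pair x n) r) (⇓-R x n)

  ⇓-add : ∀ a b → f ⊢ addᶜ · pair a b ⇓ a + b
  ⇓-add a b = subst (f ⊢ addᶜ · pair a b ⇓_) (primRec-+ a b)
    (⇓-rec _ (⇓-I a) (λ n r → ⇓-comp (⇓-R (pair a n) r) (⇓-S r)) b)

  ⇓-mul : ∀ a b → f ⊢ mulᶜ · pair a b ⇓ b * a
  ⇓-mul a b = subst (f ⊢ mulᶜ · pair a b ⇓_) (primRec-* a b)
    (⇓-rec _ (⇓-Z a) (λ n r → ⇓-comp (⇓-prd (⇓-R (pair a n) r) (⇓-param a n r)) (⇓-add r a)) b)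

  ⇓-pred : ∀ x → f ⊢ predᶜ · x ⇓ pred x
  ⇓-pred x = ⇓-comp (⇓-prd (⇓-I x) (⇓-I x))
    (subst (f ⊢ rec Z counterᶜ · pair x x ⇓_) (primRec-pred x) (⇓-rec _ (⇓-Z x) (⇓-counter x) x))

  ⇓-monus : ∀ a b → f ⊢ monusᶜ · pair a b ⇓ a ∸ b
  ⇓-monus a b = subst (f ⊢ monusᶜ · pair a b ⇓_) (primRec-∸ a b)
    (⇓-rec _ (⇓-I a) (λ n r → ⇓-comp (⇓-R (pair a n) r) (⇓-pred r)) b)

  ⇓-node : ∀ t x y → f ⊢ nodeᶜ t · pair x y ⇓ node t x y
  ⇓-node t x y = ⇓-comp (⇓-prd (⇓-const t _) (⇓-comp (⇓-prd (⇓-const 10 _) (⇓-I _)) (⇓-mul 10 (pair x y))))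
    (⇓-add t (pair x y * 10))

computes-by : ∀ {f F} c → (∀ x → f ⊢ c · x ⇓ F x) → f Computes F
computes-by {f} {F} c c⇓ = encode c , λ x → subst (λ c → f ⊢ c · x ⇓ F x) (sym (decode-encode c)) (c⇓ x)

leastAbove : (ℕ → ℕ) → ℕ → ℕ
leastAbove A m = firstZero (λ n → m ∸ A n) 0 m

leastAboveᶜ : Code → Code
leastAboveᶜ c = mu (comp monusᶜ (prd L (comp c R)))

module LeastAbove (A : ℕ → ℕ) (A-mono : A Preserves _≤_ ⟶ _≤_) (A-inflationary : ∀ n → n ≤ A n) where

  private
    m∸A[m]≡0 : ∀ m → m ∸ A (0 + m) ≡ 0
    m∸A[m]≡0 m = m≤n⇒m∸n≡0 (A-inflationary m)

  ≤-A-leastAbove : ∀ m → m ≤ A (leastAbove A m)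
  ≤-A-leastAbove m = m∸n≡0⇒m≤n (firstZero-zero (λ n → m ∸ A n) 0 m (m∸A[m]≡0 m))

  leastAbove-≤ : ∀ {m j} → m ≤ A j → leastAbove A m ≤ j
  leastAbove-≤ {m} {j} m≤Aj = ≮⇒≥ λ j<least →
    firstZero-minimal (λ n → m ∸ A n) 0 m z≤n j<least (m≤n⇒m∸n≡0 m≤Aj)

  <-leastAbove : ∀ {m j} → A j < m → j < leastAbove A m
  <-leastAbove {m} Aj<m = ≰⇒> λ least≤j → <⇒≱ Aj<m (≤-trans (≤-A-leastAbove m) (A-mono least≤j))

  leastAbove-mono-≤ : leastAbove A Preserves _≤_ ⟶ _≤_
  leastAbove-mono-≤ {m} {m'} m≤m' = leastAbove-≤ (≤-trans m≤m' (≤-A-leastAbove m'))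

  ⇓-leastAbove : ∀ {f c} → (∀ n → f ⊢ c · n ⇓ A n) → ∀ m → f ⊢ leastAboveᶜ c · m ⇓ leastAbove A m
  ⇓-leastAbove c⇓ m = ⇓-mu (λ n → m ∸ A n) m
    (λ n → ⇓-comp (⇓-prd (⇓-L m n) (⇓-comp (⇓-R m n) (c⇓ n))) (⇓-monus m (A n))) (m∸A[m]≡0 m)

-- Tuples and diagonal indices

-- tuple x k = ⟨x 0, ⟨x 1, … ⟨x (k ∸ 1), 0⟩ …⟩⟩, and cells x k j is its suffix of length j,
-- the shape in which primitive recursion builds it from the back.
cells : (ℕ → ℕ) → ℕ → ℕ → ℕ
cells x k zero    = 0
cells x k (suc j) = pair (x (k ∸ suc j)) (cells x k j)

tuple : (ℕ → ℕ) → ℕ → ℕ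
tuple x k = cells x k k

rightsᶜ : ℕ → Code
rightsᶜ zero    = I
rightsᶜ (suc d) = comp (rightsᶜ d) R

cells-mono-≤ : ∀ {x y k} → (∀ i → i < k → x i ≤ y i) → ∀ j → j ≤ k → cells x k j ≤ cells y k j
cells-mono-≤ x≤y zero    _   = z≤n
cells-mono-≤ x≤y (suc j) j<k =
  pair-mono-≤ (x≤y _ (∸-monoʳ-< z<s j<k)) (cells-mono-≤ x≤y j (<⇒≤ j<k))

tuple-mono-≤ : ∀ {x y k} → (∀ i → i < k → x i ≤ y i) → tuple x k ≤ tuple y k
tuple-mono-≤ {k = k} x≤y = cells-mono-≤ x≤y k ≤-refl

cells-const-mono-≤ : ∀ {b b' k k' j j'} → b ≤ b' → j ≤ j' → cells (λ _ → b) k j ≤ cells (λ _ → b') k' j'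
cells-const-mono-≤ {j = zero}             b≤b' _           = z≤n
cells-const-mono-≤ {j = suc j} {suc j'} b≤b' (s≤s j≤j') = pair-mono-≤ b≤b' (cells-const-mono-≤ b≤b' j≤j')

≤-cells-const : ∀ b k j → j ≤ cells (λ _ → suc b) k j
≤-cells-const b k zero    = z≤n
≤-cells-const b k (suc j) =
  ≤-trans (s≤s (≤-trans (≤-cells-const b k j) (m≤n+m _ b))) (+≤pair (suc b) (cells (λ _ → suc b) k j))

module _ {f : ℕ → ℕ} where

  ⇓-rights : ∀ x k d j → f ⊢ rightsᶜ d · cells x k (d + j) ⇓ cells x k j
  ⇓-rights x k zero    j = ⇓-I _
  ⇓-rights x k (suc d) j = ⇓-comp (⇓-R (x (k ∸ suc (d + j))) _) (⇓-rights x k d j)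

  ⇓-tuple-entry : ∀ x {e k} → e < k → f ⊢ comp L (rightsᶜ e) · tuple x k ⇓ x e
  ⇓-tuple-entry x {e} {k} e<k =
    let j , 1+e+j≡k = m≤n⇒∃[o]m+o≡n e<k
        e+1+j≡k = trans (+-suc e j) 1+e+j≡k
        k∸1+j≡e = trans (cong (_∸ suc j) (sym e+1+j≡k)) (m+n∸n≡m e (suc j))
    in subst₂ (λ n i → f ⊢ comp L (rightsᶜ e) · cells x k n ⇓ x i) e+1+j≡k k∸1+j≡e
         (⇓-comp (⇓-rights x k e (suc j)) (⇓-L _ _))

cellIndexᶜ : Code
cellIndexᶜ = prd (comp L paramᶜ) (comp monusᶜ (prd (comp R paramᶜ) (comp S counterᶜ)))

tupleᶜ : Code → Code
tupleᶜ c = comp (rec Z (prd (comp c cellIndexᶜ) R)) (prd I R)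

primRec-cells : ∀ x k j → primRec 0 (λ j r → pair (x (k ∸ suc j)) r) j ≡ cells x k j
primRec-cells x k zero    = refl
primRec-cells x k (suc j) = cong (pair (x (k ∸ suc j))) (primRec-cells x k j)

module _ {f : ℕ → ℕ} where

  ⇓-cellIndex : ∀ p k j r → f ⊢ cellIndexᶜ · pair (pair (pair p k) j) r ⇓ pair p (k ∸ suc j)
  ⇓-cellIndex p k j r =
    ⇓-prd (⇓-comp (⇓-param (pair p k) j r) (⇓-L p k))
          (⇓-comp (⇓-prd (⇓-comp (⇓-param (pair p k) j r) (⇓-R p k)) (⇓-comp (⇓-counter (pair p k) j r) (⇓-S j)))
                  (⇓-monus k (suc j)))

  ⇓-tuple : ∀ {c p x} → (∀ i → f ⊢ c · pair p i ⇓ x i) → ∀ k → f ⊢ tupleᶜ c · pair p k ⇓ tuple x k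
  ⇓-tuple {c} {p} {x} c⇓ k =
    ⇓-comp (⇓-prd (⇓-I (pair p k)) (⇓-R p k))
      (subst (f ⊢ rec Z (prd (comp c cellIndexᶜ) R) · pair (pair p k) k ⇓_) (primRec-cells x k k)
        (⇓-rec _ (⇓-Z (pair p k))
          (λ j r → ⇓-prd (⇓-comp (⇓-cellIndex p k j r) (c⇓ (k ∸ suc j))) (⇓-R (pair (pair p k) j) r)) k))

diagIndex : ℕ → ℕ → ℕ
diagIndex n e = node 6 (encode (comp L (rightsᶜ e))) (node 6 e (encode (constᶜ n)))

decode-diagIndex : ∀ n e → decode (diagIndex n e) ≡ comp (comp L (rightsᶜ e)) (comp (decode e) (constᶜ n))
decode-diagIndex n e =
  trans (decode-comp (encode (comp L (rightsᶜ e))) _) (cong₂ comp (decode-encode (comp L (rightsᶜ e)))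
    (trans (decode-comp e (encode (constᶜ n))) (cong (comp (decode e)) (decode-encode (constᶜ n)))))

node-mono-≤ : ∀ t {x x' y y'} → x ≤ x' → y ≤ y' → node t x y ≤ node t x' y'
node-mono-≤ t x≤x' y≤y' = +-monoʳ-≤ t (*-monoˡ-≤ 10 (pair-mono-≤ x≤x' y≤y'))

encode-rights-mono-≤ : ∀ {d d'} → d ≤′ d' → encode (rightsᶜ d) ≤ encode (rightsᶜ d')
encode-rights-mono-≤ ≤′-refl          = ≤-refl
encode-rights-mono-≤ (≤′-step d≤′d') = ≤-trans (encode-rights-mono-≤ d≤′d') (≤-nodeˡ 6 _ 3)

encode-const-mono-≤ : ∀ {n n'} → n ≤′ n' → encode (constᶜ n) ≤ encode (constᶜ n')
encode-const-mono-≤ ≤′-refl          = ≤-refl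
encode-const-mono-≤ (≤′-step n≤′n') = ≤-trans (encode-const-mono-≤ n≤′n') (≤-nodeʳ 6 1 _)

≤-encode-const : ∀ n → n ≤ encode (constᶜ n)
≤-encode-const zero    = z≤n
≤-encode-const (suc n) = s≤s (≤-trans (≤-encode-const n) (≤-nodeʳ 5 1 (encode (constᶜ n))))

diagIndex-mono-≤ : ∀ {n n' e e'} → n ≤ n' → e ≤ e' → diagIndex n e ≤ diagIndex n' e'
diagIndex-mono-≤ n≤n' e≤e' =
  node-mono-≤ 6 (node-mono-≤ 6 {2} ≤-refl (encode-rights-mono-≤ (≤⇒≤′ e≤e')))
    (node-mono-≤ 6 e≤e' (encode-const-mono-≤ (≤⇒≤′ n≤n')))

≤-diagIndex : ∀ n e → n ≤ diagIndex n e
≤-diagIndex n e =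
  ≤-trans (≤-encode-const n) (≤-trans (≤-nodeʳ 6 e _) (≤-nodeʳ 6 (encode (comp L (rightsᶜ e))) _))

encodeRightsᶜ encodeConstᶜ diagIndexᶜ : Code
encodeRightsᶜ = comp (rec (constᶜ 5) (comp (nodeᶜ 6) (prd R (constᶜ 3)))) (prd Z I)
encodeConstᶜ  = comp (rec Z (comp (nodeᶜ 6) (prd (constᶜ 1) R))) (prd Z I)
diagIndexᶜ    = comp (nodeᶜ 6) (prd (comp (nodeᶜ 6) (prd (constᶜ 2) (comp encodeRightsᶜ R)))
                                  (comp (nodeᶜ 6) (prd R (comp encodeConstᶜ L))))

primRec-encode-rights : ∀ d → primRec 5 (λ _ r → node 6 r 3) d ≡ encode (rightsᶜ d)
primRec-encode-rights zero    = refl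
primRec-encode-rights (suc d) = cong (λ r → node 6 r 3) (primRec-encode-rights d)

primRec-encode-const : ∀ n → primRec 0 (λ _ r → node 6 1 r) n ≡ encode (constᶜ n)
primRec-encode-const zero    = refl
primRec-encode-const (suc n) = cong (node 6 1) (primRec-encode-const n)

module _ {f : ℕ → ℕ} where

  ⇓-encodeRights : ∀ d → f ⊢ encodeRightsᶜ · d ⇓ encode (rightsᶜ d)
  ⇓-encodeRights d = ⇓-comp (⇓-prd (⇓-Z d) (⇓-I d))
    (subst (f ⊢ _ · pair 0 d ⇓_) (primRec-encode-rights d)
      (⇓-rec _ (⇓-const 5 0) (λ n r → ⇓-comp (⇓-prd (⇓-R (pair 0 n) r) (⇓-const 3 _)) (⇓-node 6 r 3)) d))

  ⇓-encodeConst : ∀ n → f ⊢ encodeConstᶜ · n ⇓ encode (constᶜ n)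
  ⇓-encodeConst n = ⇓-comp (⇓-prd (⇓-Z n) (⇓-I n))
    (subst (f ⊢ _ · pair 0 n ⇓_) (primRec-encode-const n)
      (⇓-rec _ (⇓-Z 0) (λ m r → ⇓-comp (⇓-prd (⇓-const 1 _) (⇓-R (pair 0 m) r)) (⇓-node 6 1 r)) n))

  ⇓-diagIndex : ∀ n e → f ⊢ diagIndexᶜ · pair n e ⇓ diagIndex n e
  ⇓-diagIndex n e =
    ⇓-comp (⇓-prd (⇓-comp (⇓-prd (⇓-const 2 _) (⇓-comp (⇓-R n e) (⇓-encodeRights e))) (⇓-node 6 2 _))
                  (⇓-comp (⇓-prd (⇓-R n e) (⇓-comp (⇓-L n e) (⇓-encodeConst n))) (⇓-node 6 e _)))
           (⇓-node 6 (encode (comp L (rightsᶜ e))) _)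

φ-diagIndex : ∀ {n e x k} → e < k → φ e ⟨ n ⟩↓ tuple x k → ∀ y → φ diagIndex n e ⟨ y ⟩↓ x e
φ-diagIndex {n} {e} {x} e<k φe⇓ y =
  subst (λ c → (λ _ → 0) ⊢ c · y ⇓ x e) (sym (decode-diagIndex n e))
    (⇓-comp (⇓-comp (⇓-const n y) φe⇓) (⇓-tuple-entry x e<k))

-- The construction

module Construction (h : ℕ → ℕ) (eh : ℕ) (h-computed : ∀ n → φ eh ⟨ n ⟩↓ h n)
  (h-mono : ∀ m n → m ≤ n → h m ≤ h n) (h-unbounded : ∀ m → ∃ λ n → m ≤ h n) (2≤h0 : 2 ≤ h 0) where

  tupleCap : ℕ → ℕ
  tupleCap l = suc (tuple (λ _ → suc l) l)

  tupleCap-mono-≤ : tupleCap Preserves _≤_ ⟶ _≤_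
  tupleCap-mono-≤ l≤l' = s≤s (cells-const-mono-≤ (s≤s l≤l') l≤l')

  ≤-tupleCap-suc : ∀ l → l ≤ tupleCap (suc l)
  ≤-tupleCap-suc l = m≤n⇒m≤1+n (≤-trans (n≤1+n l) (≤-cells-const (suc l) (suc l) (suc l)))

  -- The least l with h n < tupleCap (suc l), i.e. the largest l with tupleCap l ≤ h n.
  width : ℕ → ℕ
  width n = leastAbove (tupleCap ∘ suc) (suc (h n))

  private module Width = LeastAbove (tupleCap ∘ suc) (tupleCap-mono-≤ ∘ s≤s) ≤-tupleCap-suc

  tupleCap-width : ∀ n → tupleCap (width n) ≤ h n
  tupleCap-width n with width n in width≡
  ... | zero  = ≤-trans (s≤s z≤n) (≤-trans 2≤h0 (h-mono 0 n z≤n))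
  ... | suc _ = ≮⇒≥ λ hn<cap → 1+n≰n (≤-trans (≤-reflexive (sym width≡)) (Width.leastAbove-≤ hn<cap))

  ≤-width : ∀ {l n} → tupleCap l ≤ h n → l ≤ width n
  ≤-width {zero}  _       = z≤n
  ≤-width {suc j} cap≤hn = Width.<-leastAbove (s≤s cap≤hn)

  width-mono-≤ : width Preserves _≤_ ⟶ _≤_
  width-mono-≤ {m} {n} m≤n = Width.leastAbove-mono-≤ (s≤s (h-mono m n m≤n))

  width-unbounded : ∀ l → ∃ λ n → l ≤ width n
  width-unbounded l = let n , cap≤hn = h-unbounded (tupleCap l) in n , ≤-width cap≤hn

  lastQuery : ℕ → ℕ
  lastQuery n = diagIndex n (width n)

  lastQuery-mono-≤ : lastQuery Preserves _≤_ ⟶ _≤_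
  lastQuery-mono-≤ m≤n = diagIndex-mono-≤ m≤n (width-mono-≤ m≤n)

  stage : ℕ → ℕ
  stage = leastAbove lastQuery

  private module Stage = LeastAbove lastQuery lastQuery-mono-≤ (λ n → ≤-diagIndex n (width n))

  g : ℕ → ℕ
  g m = 2 + width (stage m)

  hᶜ tupleCapᶜ widthᶜ lastQueryᶜ gᶜ : Code
  hᶜ         = eraseOracle (decode eh)
  tupleCapᶜ  = comp S (comp (tupleᶜ L) (prd S I))
  widthᶜ     = comp (leastAboveᶜ (comp tupleCapᶜ S)) (comp S hᶜ)
  lastQueryᶜ = comp diagIndexᶜ (prd I widthᶜ)
  gᶜ         = comp S (comp S (comp widthᶜ (leastAboveᶜ lastQueryᶜ)))

  module _ {f : ℕ → ℕ} where

    ⇓-tupleCap : ∀ l → f ⊢ tupleCapᶜ · l ⇓ tupleCap l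
    ⇓-tupleCap l = ⇓-comp (⇓-comp (⇓-prd (⇓-S l) (⇓-I l)) (⇓-tuple {p = suc l} (⇓-L (suc l)) l)) (⇓-S _)

    ⇓-width : ∀ n → f ⊢ widthᶜ · n ⇓ width n
    ⇓-width n = ⇓-comp (⇓-comp (⇓-eraseOracle (h-computed n)) (⇓-S (h n)))
      (Width.⇓-leastAbove (λ l → ⇓-comp (⇓-S l) (⇓-tupleCap (suc l))) (suc (h n)))

    ⇓-lastQuery : ∀ n → f ⊢ lastQueryᶜ · n ⇓ lastQuery n
    ⇓-lastQuery n = ⇓-comp (⇓-prd (⇓-I n) (⇓-width n)) (⇓-diagIndex n (width n))

    ⇓-g : ∀ m → f ⊢ gᶜ · m ⇓ g m
    ⇓-g m = ⇓-comp (⇓-comp (⇓-comp (Stage.⇓-leastAbove ⇓-lastQuery m) (⇓-width (stage m))) (⇓-S _)) (⇓-S _)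

  g-unbounded : ∀ l → ∃ λ m → l ≤ g m
  g-unbounded l =
    let n , l≤width = width-unbounded l
        n<stage = Stage.<-leastAbove (n<1+n (lastQuery n))
    in suc (lastQuery n) , ≤-trans l≤width (≤-trans (width-mono-≤ (<⇒≤ n<stage)) (m≤n+m _ 2))

  g-orderFunction : OrderFunction g
  g-orderFunction =
    computes-by gᶜ ⇓-g , (λ _ _ → s≤s ∘ s≤s ∘ width-mono-≤ ∘ Stage.leastAbove-mono-≤) , g-unbounded , s≤s (s≤s z≤n)

  g-diagIndex-≤ : ∀ {n e} → e ≤ width n → g (diagIndex n e) ≤ 2 + width n
  g-diagIndex-≤ {n} e≤width = s≤s (s≤s (width-mono-≤ (Stage.leastAbove-≤ (diagIndex-mono-≤ {n = n} ≤-refl e≤width))))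

  reduction : (ℕ → ℕ) → ℕ → ℕ
  reduction f n = tuple (f ∘ diagIndex n) (width n)

  computes-reduction : ∀ f → f Computes reduction f
  computes-reduction f = computes-by (comp (tupleᶜ (comp O diagIndexᶜ)) (prd I widthᶜ)) λ n →
    ⇓-comp (⇓-prd (⇓-I n) (⇓-width n)) (⇓-tuple {p = n} (λ e → ⇓-comp (⇓-diagIndex n e) (⇓-O _)) (width n))

  reduction-bounded : ∀ {f} → BoundedBy f g → BoundedBy (reduction f) h
  reduction-bounded {f} f<g n = ≤-trans (s≤s (tuple-mono-≤ entry≤)) (tupleCap-width n)
    where
    entry≤ : ∀ e → e < width n → f (diagIndex n e) ≤ suc (width n)
    entry≤ e e<width = s≤s⁻¹ (≤-trans (f<g (diagIndex n e)) (g-diagIndex-≤ (<⇒≤ e<width)))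

  reduction-snpr : ∀ {f} → DNR f → SNPR (reduction f)
  reduction-snpr {f} f-dnr e =
    let n₀ , e<width = width-unbounded (suc e)
    in n₀ , λ n n₀≤n v φe⇓v f'n≡v →
      let a = diagIndex n e
          φe⇓f'n = subst (φ e ⟨ n ⟩↓_) (sym f'n≡v) φe⇓v
      in f-dnr a (f a) (φ-diagIndex (≤-trans e<width (width-mono-≤ n₀≤n)) φe⇓f'n a) refl

theorem1 : (h : ℕ → ℕ) → OrderFunction h →
    Σ (ℕ → ℕ) λ g → OrderFunction g ×
      ((f : ℕ → ℕ) → DNR f → BoundedBy f g →
        Σ (ℕ → ℕ) λ f' → SNPR f' × BoundedBy f' h × f Computes f')
theorem1 h ((eh , h-computed) , h-mono , h-unbounded , 2≤h0) =
  g , g-orderFunction , λ f f-dnr f<g →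
    reduction f , reduction-snpr f-dnr , reduction-bounded f<g , computes-reduction f
  where open Construction h eh h-computed h-mono h-unbounded 2≤h0
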